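{- Let $G$ be a simple undirected graph. The following statements are equivalent. (a) $G$ belongs to $\mathcal{G_T}$, i.e. $G$ is isomorphic to the non-ancestor graph $G(T)$ of some rooted tree $T$ whose root has at least two branches. (b) $G = G_{\{0\}}(L)$ for some finite lower dismantlable lattice $L$ whose greatest element $1$ is join-reducible. (c) $G$ is the incomparability graph of the poset $(L\setminus\{0,1\},\leq)$ for some finite lower dismantlable lattice $L$ whose greatest element $1$ is join-reducible.
   Context: All lattices are finite. Adjunct operation: if $L_1, L_2$ are disjoint finite lattices and $a<b$ in $L_1$ with $b$ not covering $a$, the adjunct $L=L_1]_a^bL_2$ is the set $L_1\cup L_2$ ordered by: $x\le y$ iff ($x,y\in L_1$ and $x\le y$ in $L_1$) or ($x,y\in L_2$ and $x\le y$ in $L_2$) or ($x\in L_1$, $y\in L_2$, $x\le a$) or ($x\in L_2$, $y\in L_1$, $b\le y$); it is a lattice, and $(a,b)$ is called an adjunct pair. A finite lattice is dismantlable iff it is obtained from chains by successive adjunct operations, $L=C_0]_{a_1}^{b_1}C_1]_{a_2}^{b_2}\cdots]_{a_n}^{b_n}C_n$ with chains $C_i$. A dismantlable lattice $L$ is lower dismantlable if it is a chain or every adjunct pair in (its adjunct representation) is of the form $(0,b)$. An element $x$ is join-reducible if $x=y\vee z$ for some $y,z\ne x$. The zero-divisor graph $G_{\{0\}}(L)$ of a lattice $L$ with $0$ has vertex set $\{x\in L\setminus\{0\} : x\wedge y=0 \text{ for some } y\in L\setminus\{0\}\}$, distinct vertices $x,y$ being adjacent iff $x\wedge y=0$. For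 a rooted tree $T$ with root $R$ having at least two branches, a vertex $w$ is an ancestor of $v$ if $w$ lies on the unique path from $v$ to $R$; the non-ancestor graph $G(T)$ has vertex set $V(T)\setminus\{R\}$, two vertices being adjacent iff neither is an ancestor of the other. The incomparability graph of a poset has the poset's elements as vertices, two being adjacent iff they are incomparable. -}

module Defs where

import Level
open Level using (Level)
open import Data.Nat using (ℕ; zero; suc; _+_; _≤_)
open import Data.Fin using (Fin; zero; suc; toℕ; splitAt)
open import Data.Sum using (_⊎_; inj₁; inj₂)
open import Data.Product using (Σ; _×_; _,_; ∃; ∃-syntax)
open import Data.Unit using (⊤)
open import Relation.Nullary using (¬_)
open import Relation.Binary.PropositionalEquality using (_≡_; _≢_)

record SimpleGraph : Set₁ where
  field
    V      : Set
    E      : V → V → Set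
    sym    : ∀ {x y} → E x y → E y x
    irrefl : ∀ {x} → ¬ E x x

record FinGraph : Set₁ where
  field
    m : ℕ
    S : Fin m → Set
    A : Fin m → Fin m → Set

record _≅_ (G : SimpleGraph) (H : FinGraph) : Set where
  open SimpleGraph G
  open FinGraph H
  field
    f        : V → Fin m
    f-in     : ∀ x → S (f x)
    f-inj    : ∀ x y → f x ≡ f y → x ≡ y
    f-surj   : ∀ y → S y → ∃[ x ] (f x ≡ y)
    adj-to   : ∀ x y → E x y → A (f x) (f y)
    adj-from : ∀ x y → A (f x) (f y) → E x y

-- A rooted tree with n non-root vertices has vertex set
-- Fin (suc n), root zero, and the vertex  suc i  has parent  par i,
-- where the parent has smaller label (toℕ (par i) ≤ toℕ i < toℕ (suc i)).
-- Every finite rooted tree admits such a labelling (e.g. BFS order).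

record RootedTree : Set where
  field
    n      : ℕ
    par    : Fin n → Fin (suc n)
    par-lt : ∀ i → toℕ (par i) ≤ toℕ i

-- Anc T w v : w lies on the unique path from v to the root.
data Anc (T : RootedTree) : Fin (suc (RootedTree.n T)) → Fin (suc (RootedTree.n T)) → Set where
  here : ∀ {v} → Anc T v v
  up   : ∀ {w i} → Anc T w (RootedTree.par T i) → Anc T w (suc i)

RootHasTwoBranches : RootedTree → Set
RootHasTwoBranches T =
  Σ (Fin n) λ i → Σ (Fin n) λ j → i ≢ j × par i ≡ zero × par j ≡ zero
  where open RootedTree T

NonAncestorGraph : RootedTree → FinGraph
NonAncestorGraph T = record
  { m = suc (RootedTree.n T)
  ; S = λ v → v ≢ zero
  ; A = λ v w → ¬ Anc T v w × ¬ Anc T w v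
  }

Rel : ℕ → Set₁
Rel k = Fin k → Fin k → Set

ChainR : ∀ k → Rel k
ChainR k x y = toℕ x ≤ toℕ y

Covers : ∀ {k} → Rel k → Fin k → Fin k → Set
Covers R a b = R a b × a ≢ b × (∀ c → R a c → R c b → c ≡ a ⊎ c ≡ b)

-- The adjunct L1 ]_a^b L2 on Fin (k1 + k2) (first k1 elements are L1).
AdjR : ∀ k1 {k2} → Rel k1 → Rel k2 → Fin k1 → Fin k1 → Rel (k1 + k2)
AdjR k1 R1 R2 a b x y with splitAt k1 x | splitAt k1 y
... | inj₁ x₁ | inj₁ y₁ = R1 x₁ y₁
... | inj₂ x₂ | inj₂ y₂ = R2 x₂ y₂
... | inj₁ x₁ | inj₂ _  = R1 x₁ a
... | inj₂ _  | inj₁ y₁ = R1 b y₁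

-- Lower dismantlable lattices: built from a (nonempty) chain by
-- successively adjoining (nonempty) chains via adjunct pairs (0,b),
-- with 0 < b in the current lattice and b not covering 0.
data LowerDismantlable : (k : ℕ) → Rel k → Set₁ where
  chain : ∀ m → LowerDismantlable (suc m) (ChainR (suc m))
  adj   : ∀ {k R} → LowerDismantlable k R →
          (a b : Fin k) → (∀ x → R a x) →
          R a b → a ≢ b → ¬ Covers R a b →
          ∀ m → LowerDismantlable (k + suc m) (AdjR k R (ChainR (suc m)) a b)

IsBottom : ∀ {k} → Rel k → Fin k → Set
IsBottom R z = ∀ x → R z x

IsTop : ∀ {k} → Rel k → Fin k → Set
IsTop R t = ∀ x → R x t

MeetIs : ∀ {k} → Rel k → Fin k → Fin k → Fin k → Set
MeetIs R x y m = R m x × R m y × (∀ w → R w x → R w y → R w m)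

JoinIs : ∀ {k} → Rel k → Fin k → Fin k → Fin k → Set
JoinIs R x y j = R x j × R y j × (∀ w → R x w → R y w → R j w)

JoinReducible : ∀ {k} → Rel k → Fin k → Set
JoinReducible R x = ∃[ y ] ∃[ z ] (y ≢ x × z ≢ x × JoinIs R y z x)

ZeroDivisorGraph : ∀ {k} → Rel k → Fin k → FinGraph
ZeroDivisorGraph {k} R z = record
  { m = k
  ; S = λ x → x ≢ z × ∃[ y ] (y ≢ z × MeetIs R x y z)
  ; A = λ x y → x ≢ y × MeetIs R x y z
  }

IncompGraph01 : ∀ {k} → Rel k → Fin k → Fin k → FinGraph
IncompGraph01 {k} R z t = record
  { m = k
  ; S = λ x → x ≢ z × x ≢ t
  ; A = λ x y → ¬ R x y × ¬ R y x
  }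

CondA : SimpleGraph → Set
CondA G = ∃[ T ] (RootHasTwoBranches T × (G ≅ NonAncestorGraph T))

CondB : SimpleGraph → Set₁
CondB G = Σ ℕ λ k → Σ (Rel k) λ R → LowerDismantlable k R ×
  Σ (Fin k) λ z → Σ (Fin k) λ t → IsBottom R z × IsTop R t ×
  JoinReducible R t × (G ≅ ZeroDivisorGraph R z)

CondC : SimpleGraph → Set₁
CondC G = Σ ℕ λ k → Σ (Rel k) λ R → LowerDismantlable k R ×
  Σ (Fin k) λ z → Σ (Fin k) λ t → IsBottom R z × IsTop R t ×
  JoinReducible R t × (G ≅ IncompGraph01 R z t)

_⇔_ : ∀ {a b : Level} → Set a → Set b → Set (a Level.⊔ b)
P ⇔ Q = (P → Q) × (Q → P)

-- Building a lower dismantlable lattice L with adjunct pairs (0, b) only ever adds a new atom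
-- below an existing element x, keeping the up-set of x: in the poset L ∖ {0}, ordered dually,
-- this adds a new leaf below x.  Hence L ∖ {0} is a rooted tree whose root is 1, and every
-- rooted tree arises this way: a new leaf below a vertex p with children is a one-element chain
-- adjoined at (0, p), a new leaf below a leaf p lengthens the chain through p.  Under this
-- correspondence non-ancestry is incomparability in L ∖ {0, 1}, and 1 is join-reducible iff the
-- root has two branches.  Two nonzero elements of a tree-like L meet in 0 iff they are
-- incomparable, and a second branch gives every element other than 0, 1 such a partner, so
-- G₀(L) is the incomparability graph of L ∖ {0, 1}.
module Submission where

open import Defs
open import Data.Nat as ℕ using (ℕ; zero; suc; _+_; _≤_; _<_; z≤n; s≤s)
import Data.Nat.Properties as ℕₚ
open import Data.Fin as Fin using (Fin; zero; suc; toℕ; splitAt; _↑ˡ_; _↑ʳ_; inject₁; fromℕ; fromℕ<)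
import Data.Fin.Properties as Finₚ
open import Data.Fin.Properties using (splitAt-↑ˡ; splitAt-↑ʳ; ↑ˡ-injective; ↑ʳ-injective; suc-injective)
import Data.Fin.Relation.Unary.Top as Top
open import Data.Sum as Sum using (_⊎_; inj₁; inj₂)
open import Data.Product using (Σ; _×_; _,_; proj₁; proj₂; ∃; ∃-syntax)
open import Data.Empty using (⊥-elim)
open import Relation.Nullary using (¬_; Dec; yes; no)
open import Relation.Binary.PropositionalEquality using (_≡_; _≢_; refl; sym; trans; cong; subst; subst₂)

Incomparable : ∀ {k} → Rel k → Fin k → Fin k → Set
Incomparable R x y = ¬ R x y × ¬ R y x

record FinGraphIso (H H′ : FinGraph) : Set where
  module H  = FinGraph H
  module H′ = FinGraph H′
  field
    g           : Fin H.m → Fin H′.m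
    g-in        : ∀ x → H.S x → H′.S (g x)
    g-injective : ∀ x y → H.S x → H.S y → g x ≡ g y → x ≡ y
    g-onto      : ∀ y → H′.S y → Σ (Fin H.m) λ x → H.S x × g x ≡ y
    g-adj       : ∀ x y → H.S x → H.S y → H.A x y → H′.A (g x) (g y)
    g-adj⁻      : ∀ x y → H.S x → H.S y → H′.A (g x) (g y) → H.A x y

≅-trans : ∀ {G H H′} → G ≅ H → FinGraphIso H H′ → G ≅ H′
≅-trans {H′ = H′} iso φ = record
  { f = λ x → g (f x)
  ; f-in = λ x → g-in (f x) (f-in x)
  ; f-inj = λ x y eq → f-inj x y (g-injective _ _ (f-in x) (f-in y) eq)
  ; f-surj = onto
  ; adj-to = λ x y e → g-adj _ _ (f-in x) (f-in y) (adj-to x y e)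
  ; adj-from = λ x y a → adj-from x y (g-adj⁻ _ _ (f-in x) (f-in y) a)
  }
  where
  open _≅_ iso
  open FinGraphIso φ
  onto : ∀ y → FinGraph.S H′ y → ∃[ x ] g (f x) ≡ y
  onto y Sy with g-onto y Sy
  ... | x′ , Sx′ , refl with f-surj x′ Sx′
  ...   | x , refl = x , refl

-- Pulls an isomorphism back along φ, using that every vertex of H′ has a φ-preimage.
≅-trans⁻¹ : ∀ {G H H′} → G ≅ H′ → FinGraphIso H H′ → G ≅ H
≅-trans⁻¹ {G} {H} {H′} iso φ = record
  { f = f′
  ; f-in = f′-in
  ; f-inj = λ x y eq → f-inj x y (trans (sym (g∘f′ x)) (trans (cong g eq) (g∘f′ y)))
  ; f-surj = onto
  ; adj-to = λ x y e → g-adj⁻ _ _ (f′-in x) (f′-in y)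
                         (subst₂ (FinGraph.A H′) (sym (g∘f′ x)) (sym (g∘f′ y)) (adj-to x y e))
  ; adj-from = λ x y a → adj-from x y
                           (subst₂ (FinGraph.A H′) (g∘f′ x) (g∘f′ y) (g-adj _ _ (f′-in x) (f′-in y) a))
  }
  where
  open _≅_ iso
  open FinGraphIso φ
  f′ : SimpleGraph.V G → Fin (FinGraph.m H)
  f′ x = proj₁ (g-onto (f x) (f-in x))
  f′-in : ∀ x → FinGraph.S H (f′ x)
  f′-in x = proj₁ (proj₂ (g-onto (f x) (f-in x)))
  g∘f′ : ∀ x → g (f′ x) ≡ f x
  g∘f′ x = proj₂ (proj₂ (g-onto (f x) (f-in x)))
  onto : ∀ y → FinGraph.S H y → ∃[ x ] f′ x ≡ y
  onto y Sy with f-surj (g y) (g-in y Sy)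
  ... | x , fx≡gy = x , g-injective _ _ (f′-in x) Sy (trans (g∘f′ x) fx≡gy)

sameVertices-FinGraphIso : ∀ {k} {S S′ : Fin k → Set} {A A′ : Fin k → Fin k → Set} →
  (∀ x → S x → S′ x) → (∀ x → S′ x → S x) →
  (∀ x y → S x → S y → A x y → A′ x y) → (∀ x y → S x → S y → A′ x y → A x y) →
  FinGraphIso (record { m = k ; S = S ; A = A }) (record { m = k ; S = S′ ; A = A′ })
sameVertices-FinGraphIso S⇒S′ S′⇒S A⇒A′ A′⇒A = record
  { g = λ x → x ; g-in = S⇒S′ ; g-injective = λ _ _ _ _ eq → eq
  ; g-onto = λ y S′y → y , S′⇒S y S′y , refl ; g-adj = A⇒A′ ; g-adj⁻ = A′⇒A }

IsMinimal : ∀ {k} → Rel k → Fin k → Set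
IsMinimal R a = ∀ y → R y a → y ≡ a

data Split (m n : ℕ) : Fin (m + n) → Set where
  inl : (i : Fin m) → Split m n (i ↑ˡ n)
  inr : (j : Fin n) → Split m n (m ↑ʳ j)

split : ∀ m {n} (i : Fin (m + n)) → Split m n i
split zero    i       = inr i
split (suc m) zero    = inl zero
split (suc m) (suc i) with split m i
... | inl i = inl (suc i)
... | inr j = inr j

↑ˡ≢↑ʳ : ∀ {m n} (i : Fin m) (j : Fin n) → i ↑ˡ n ≢ m ↑ʳ j
↑ˡ≢↑ʳ zero    j ()
↑ˡ≢↑ʳ (suc i) j eq = ↑ˡ≢↑ʳ i j (suc-injective eq)

module Adjunct {k₁ k₂ : ℕ} (R₁ : Rel k₁) (R₂ : Rel k₂) (a b : Fin k₁) where

  _⊑_ : Rel (k₁ + k₂)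
  _⊑_ = AdjR k₁ R₁ R₂ a b

  ˡˡ⁺ : ∀ x y → R₁ x y → (x ↑ˡ k₂) ⊑ (y ↑ˡ k₂)
  ˡˡ⁺ x y r rewrite splitAt-↑ˡ k₁ x k₂ | splitAt-↑ˡ k₁ y k₂ = r

  ˡˡ⁻ : ∀ x y → (x ↑ˡ k₂) ⊑ (y ↑ˡ k₂) → R₁ x y
  ˡˡ⁻ x y r rewrite splitAt-↑ˡ k₁ x k₂ | splitAt-↑ˡ k₁ y k₂ = r

  ʳʳ⁺ : ∀ x y → R₂ x y → (k₁ ↑ʳ x) ⊑ (k₁ ↑ʳ y)
  ʳʳ⁺ x y r rewrite splitAt-↑ʳ k₁ k₂ x | splitAt-↑ʳ k₁ k₂ y = r

  ʳʳ⁻ : ∀ x y → (k₁ ↑ʳ x) ⊑ (k₁ ↑ʳ y) → R₂ x y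
  ʳʳ⁻ x y r rewrite splitAt-↑ʳ k₁ k₂ x | splitAt-↑ʳ k₁ k₂ y = r

  ˡʳ⁺ : ∀ x y → R₁ x a → (x ↑ˡ k₂) ⊑ (k₁ ↑ʳ y)
  ˡʳ⁺ x y r rewrite splitAt-↑ˡ k₁ x k₂ | splitAt-↑ʳ k₁ k₂ y = r

  ˡʳ⁻ : ∀ x y → (x ↑ˡ k₂) ⊑ (k₁ ↑ʳ y) → R₁ x a
  ˡʳ⁻ x y r rewrite splitAt-↑ˡ k₁ x k₂ | splitAt-↑ʳ k₁ k₂ y = r

  ʳˡ⁺ : ∀ x y → R₁ b y → (k₁ ↑ʳ x) ⊑ (y ↑ˡ k₂)
  ʳˡ⁺ x y r rewrite splitAt-↑ʳ k₁ k₂ x | splitAt-↑ˡ k₁ y k₂ = r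

  ʳˡ⁻ : ∀ x y → (k₁ ↑ʳ x) ⊑ (y ↑ˡ k₂) → R₁ b y
  ʳˡ⁻ x y r rewrite splitAt-↑ʳ k₁ k₂ x | splitAt-↑ˡ k₁ y k₂ = r

  ⊑-bottom : IsBottom R₁ a → IsBottom _⊑_ (a ↑ˡ k₂)
  ⊑-bottom bot y with split k₁ y
  ... | inl j = ˡˡ⁺ a j (bot j)
  ... | inr j = ˡʳ⁺ a j (bot a)

  ⊑-minimal⁻ : ∀ {x} → IsMinimal _⊑_ (x ↑ˡ k₂) → IsMinimal R₁ x
  ⊑-minimal⁻ min y r = ↑ˡ-injective k₂ y _ (min (y ↑ˡ k₂) (ˡˡ⁺ y _ r))

  ⊑-Covers⁻ : ∀ {x y} → Covers _⊑_ (x ↑ˡ k₂) (y ↑ˡ k₂) → Covers R₁ x y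
  ⊑-Covers⁻ {x} {y} (x≤y , x≢y , between) =
    ˡˡ⁻ x y x≤y , (λ eq → x≢y (cong (_↑ˡ k₂) eq)) , λ c r₁ r₂ →
      Sum.map (↑ˡ-injective k₂ c x) (↑ˡ-injective k₂ c y) (between (c ↑ˡ k₂) (ˡˡ⁺ x c r₁) (ˡˡ⁺ c y r₂))

-- R′ is R with one new element, covering a, whose strict up-set is the up-set of x.
-- When a is the bottom, this adds a new atom directly below x.
record AtomExtension {k k′} (R : Rel k) (R′ : Rel k′) (a x : Fin k) : Set where
  field
    ι           : Fin k → Fin k′
    new         : Fin k′
    ι-injective : ∀ y y′ → ι y ≡ ι y′ → y ≡ y′
    ι≢new       : ∀ y → ι y ≢ new
    new-or-ι    : ∀ y → y ≡ new ⊎ ∃[ y₀ ] ι y₀ ≡ y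
    ι-mono      : ∀ y y′ → R y y′ → R′ (ι y) (ι y′)
    ι-reflects  : ∀ y y′ → R′ (ι y) (ι y′) → R y y′
    new≤ι⁺      : ∀ y → R x y → R′ new (ι y)
    new≤ι⁻      : ∀ y → R′ new (ι y) → R x y
    ι[a]≤new    : R′ (ι a) new
    ι≤new⇒≡a    : ∀ y → R′ (ι y) new → y ≡ a
    new≤new     : R′ new new

module _ {k k′} {R : Rel k} {R′ : Rel k′} {a x : Fin k} (E : AtomExtension R R′ a x) where
  open AtomExtension E

  ι-bottom : IsBottom R a → IsBottom R′ (ι a)
  ι-bottom bot y with new-or-ι y
  ... | inj₁ refl       = ι[a]≤new
  ... | inj₂ (y₀ , refl) = ι-mono a y₀ (bot y₀)

  ι-minimal : x ≢ a → IsMinimal R a → IsMinimal R′ (ι a)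
  ι-minimal x≢a min y r with new-or-ι y
  ... | inj₁ refl       = ⊥-elim (x≢a (min x (new≤ι⁻ a r)))
  ... | inj₂ (y₀ , refl) = cong ι (min y₀ (ι-reflects y₀ a r))

  ι-¬Covers : ∀ {c d} → ¬ Covers R c d → ¬ Covers R′ (ι c) (ι d)
  ι-¬Covers {c} {d} ¬cov (ιc≤ιd , ιc≢ιd , between) =
    ¬cov (ι-reflects c d ιc≤ιd , (λ eq → ιc≢ιd (cong ι eq)) , λ y r₁ r₂ →
      Sum.map (ι-injective y c) (ι-injective y d) (between (ι y) (ι-mono c y r₁) (ι-mono y d r₂)))

adjoinPoint : ∀ {k} {R : Rel k} {a : Fin k} (b : Fin k) → IsBottom R a → IsMinimal R a →
              AtomExtension R (AdjR k R (ChainR 1) a b) a b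
adjoinPoint {k} {R} {a} b bot min = record
  { ι = _↑ˡ 1 ; new = k ↑ʳ zero
  ; ι-injective = ↑ˡ-injective 1 ; ι≢new = λ y → ↑ˡ≢↑ʳ y zero ; new-or-ι = new-or-ι
  ; ι-mono = ˡˡ⁺ ; ι-reflects = ˡˡ⁻ ; new≤ι⁺ = ʳˡ⁺ zero ; new≤ι⁻ = ʳˡ⁻ zero
  ; ι[a]≤new = ˡʳ⁺ a zero (bot a) ; ι≤new⇒≡a = λ y r → min y (ˡʳ⁻ y zero r)
  ; new≤new = ʳʳ⁺ zero zero z≤n }
  where
  open Adjunct R (ChainR 1) a b
  new-or-ι : ∀ y → y ≡ k ↑ʳ zero ⊎ ∃[ y₀ ] y₀ ↑ˡ 1 ≡ y
  new-or-ι y with split k y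
  ... | inl j    = inj₂ (j , refl)
  ... | inr zero = inj₁ refl

chainAtomExtension : ∀ m → AtomExtension (ChainR (suc (suc m))) (ChainR (suc (suc (suc m)))) zero (suc zero)
chainAtomExtension m = record
  { ι = ι ; new = suc zero ; ι-injective = ι-injective ; ι≢new = ι≢new ; new-or-ι = new-or-ι
  ; ι-mono = ι-mono ; ι-reflects = ι-reflects ; new≤ι⁺ = new≤ι⁺ ; new≤ι⁻ = new≤ι⁻
  ; ι[a]≤new = z≤n ; ι≤new⇒≡a = ι≤new⇒≡a ; new≤new = s≤s z≤n }
  where
  ι : Fin (suc (suc m)) → Fin (suc (suc (suc m)))
  ι zero    = zero
  ι (suc y) = suc (suc y)

  ι-injective : ∀ y y′ → ι y ≡ ι y′ → y ≡ y′
  ι-injective zero    zero     _  = refl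
  ι-injective (suc y) (suc y′) eq = cong suc (suc-injective (suc-injective eq))

  ι≢new : ∀ y → ι y ≢ suc zero
  ι≢new zero    ()
  ι≢new (suc y) ()

  new-or-ι : ∀ y → y ≡ suc zero ⊎ ∃[ y₀ ] ι y₀ ≡ y
  new-or-ι zero          = inj₂ (zero , refl)
  new-or-ι (suc zero)    = inj₁ refl
  new-or-ι (suc (suc y)) = inj₂ (suc y , refl)

  ι-mono : ∀ y y′ → ChainR _ y y′ → ChainR _ (ι y) (ι y′)
  ι-mono zero    y′       _ = z≤n
  ι-mono (suc y) (suc y′) r = s≤s r

  ι-reflects : ∀ y y′ → ChainR _ (ι y) (ι y′) → ChainR _ y y′
  ι-reflects zero    y′       _       = z≤n
  ι-reflects (suc y) (suc y′) (s≤s r) = r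

  new≤ι⁺ : ∀ y → ChainR _ (suc zero) y → ChainR _ (suc zero) (ι y)
  new≤ι⁺ (suc y) _ = s≤s z≤n

  new≤ι⁻ : ∀ y → ChainR _ (suc zero) (ι y) → ChainR _ (suc zero) y
  new≤ι⁻ (suc y) _ = s≤s z≤n

  ι≤new⇒≡a : ∀ y → ChainR _ (ι y) (suc zero) → y ≡ zero
  ι≤new⇒≡a zero    _           = refl
  ι≤new⇒≡a (suc y) (s≤s ())

-- In L ]₀ᵇ C, lengthening the chain C at its bottom adds a new atom below the old bottom of C.
lengthenAdjunctChain : ∀ {k} {R : Rel k} {a : Fin k} (b : Fin k) → IsBottom R a → IsMinimal R a → ∀ m →
  AtomExtension (AdjR k R (ChainR (suc m)) a b) (AdjR k R (ChainR (suc (suc m))) a b) (a ↑ˡ suc m) (k ↑ʳ zero)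
lengthenAdjunctChain {k} {R} {a} b bot min m = record
  { ι = ι ; new = k ↑ʳ zero ; ι-injective = ι-injective ; ι≢new = ι≢new ; new-or-ι = new-or-ι
  ; ι-mono = ι-mono ; ι-reflects = ι-reflects ; new≤ι⁺ = new≤ι⁺ ; new≤ι⁻ = new≤ι⁻
  ; ι[a]≤new = ι[a]≤new ; ι≤new⇒≡a = ι≤new⇒≡a ; new≤new = A′.ʳʳ⁺ zero zero z≤n }
  where
  module A  = Adjunct R (ChainR (suc m)) a b
  module A′ = Adjunct R (ChainR (suc (suc m))) a b

  ι : Fin (k + suc m) → Fin (k + suc (suc m))
  ι y = Fin.join k (suc (suc m)) (Sum.map₂ suc (splitAt k y))

  ι-ˡ : ∀ j → ι (j ↑ˡ suc m) ≡ j ↑ˡ suc (suc m)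
  ι-ˡ j rewrite splitAt-↑ˡ k j (suc m) = refl

  ι-ʳ : ∀ c → ι (k ↑ʳ c) ≡ k ↑ʳ suc c
  ι-ʳ c rewrite splitAt-↑ʳ k (suc m) c = refl

  ι-injective : ∀ y y′ → ι y ≡ ι y′ → y ≡ y′
  ι-injective y y′ eq with split k y | split k y′
  ... | inl j | inl j′ rewrite ι-ˡ j | ι-ˡ j′ = cong (_↑ˡ suc m) (↑ˡ-injective _ j j′ eq)
  ... | inl j | inr c′ rewrite ι-ˡ j | ι-ʳ c′ = ⊥-elim (↑ˡ≢↑ʳ j (suc c′) eq)
  ... | inr c | inl j′ rewrite ι-ʳ c | ι-ˡ j′ = ⊥-elim (↑ˡ≢↑ʳ j′ (suc c) (sym eq))
  ... | inr c | inr c′ rewrite ι-ʳ c | ι-ʳ c′ = cong (k ↑ʳ_) (suc-injective (↑ʳ-injective k _ _ eq))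

  ι≢new : ∀ y → ι y ≢ k ↑ʳ zero
  ι≢new y eq with split k y
  ... | inl j rewrite ι-ˡ j = ↑ˡ≢↑ʳ j zero eq
  ... | inr c rewrite ι-ʳ c with ↑ʳ-injective k _ _ eq
  ... | ()

  new-or-ι : ∀ y → y ≡ k ↑ʳ zero ⊎ ∃[ y₀ ] ι y₀ ≡ y
  new-or-ι y with split k y
  ... | inl j       = inj₂ (j ↑ˡ suc m , ι-ˡ j)
  ... | inr zero    = inj₁ refl
  ... | inr (suc c) = inj₂ (k ↑ʳ c , ι-ʳ c)

  ι-mono : ∀ y y′ → A._⊑_ y y′ → A′._⊑_ (ι y) (ι y′)
  ι-mono y y′ r with split k y | split k y′
  ... | inl j | inl j′ rewrite ι-ˡ j | ι-ˡ j′ = A′.ˡˡ⁺ j j′ (A.ˡˡ⁻ j j′ r)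
  ... | inl j | inr c′ rewrite ι-ˡ j | ι-ʳ c′ = A′.ˡʳ⁺ j (suc c′) (A.ˡʳ⁻ j c′ r)
  ... | inr c | inl j′ rewrite ι-ʳ c | ι-ˡ j′ = A′.ʳˡ⁺ (suc c) j′ (A.ʳˡ⁻ c j′ r)
  ... | inr c | inr c′ rewrite ι-ʳ c | ι-ʳ c′ = A′.ʳʳ⁺ (suc c) (suc c′) (s≤s (A.ʳʳ⁻ c c′ r))

  ι-reflects : ∀ y y′ → A′._⊑_ (ι y) (ι y′) → A._⊑_ y y′
  ι-reflects y y′ r with split k y | split k y′
  ... | inl j | inl j′ rewrite ι-ˡ j | ι-ˡ j′ = A.ˡˡ⁺ j j′ (A′.ˡˡ⁻ j j′ r)
  ... | inl j | inr c′ rewrite ι-ˡ j | ι-ʳ c′ = A.ˡʳ⁺ j c′ (A′.ˡʳ⁻ j (suc c′) r)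
  ... | inr c | inl j′ rewrite ι-ʳ c | ι-ˡ j′ = A.ʳˡ⁺ c j′ (A′.ʳˡ⁻ (suc c) j′ r)
  ... | inr c | inr c′ rewrite ι-ʳ c | ι-ʳ c′ = A.ʳʳ⁺ c c′ (ℕ.s≤s⁻¹ (A′.ʳʳ⁻ (suc c) (suc c′) r))

  new≤ι⁺ : ∀ y → A._⊑_ (k ↑ʳ zero) y → A′._⊑_ (k ↑ʳ zero) (ι y)
  new≤ι⁺ y r with split k y
  ... | inl j rewrite ι-ˡ j = A′.ʳˡ⁺ zero j (A.ʳˡ⁻ zero j r)
  ... | inr c rewrite ι-ʳ c = A′.ʳʳ⁺ zero (suc c) z≤n

  new≤ι⁻ : ∀ y → A′._⊑_ (k ↑ʳ zero) (ι y) → A._⊑_ (k ↑ʳ zero) y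
  new≤ι⁻ y r with split k y
  ... | inl j rewrite ι-ˡ j = A.ʳˡ⁺ zero j (A′.ʳˡ⁻ zero j r)
  ... | inr c rewrite ι-ʳ c = A.ʳʳ⁺ zero c z≤n

  ι[a]≤new : A′._⊑_ (ι (a ↑ˡ suc m)) (k ↑ʳ zero)
  ι[a]≤new rewrite ι-ˡ a = A′.ˡʳ⁺ a zero (bot a)

  ι≤new⇒≡a : ∀ y → A′._⊑_ (ι y) (k ↑ʳ zero) → y ≡ a ↑ˡ suc m
  ι≤new⇒≡a y r with split k y
  ... | inl j rewrite ι-ˡ j = cong (_↑ˡ suc m) (min j (A′.ˡʳ⁻ j zero r))
  ... | inr c rewrite ι-ʳ c with A′.ʳʳ⁻ (suc c) zero r
  ... | ()

adjunctAtomExtension : ∀ {k k′ k₂} {R : Rel k} {R′ : Rel k′} {a x : Fin k} (E : AtomExtension R R′ a x) →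
  (C : Rel k₂) (b : Fin k) → b ≢ a →
  let open AtomExtension E in
  AtomExtension (AdjR k R C a b) (AdjR k′ R′ C (ι a) (ι b)) (a ↑ˡ k₂) (x ↑ˡ k₂)
adjunctAtomExtension {k} {k′} {k₂} {R} {R′} {a} {x} E C b b≢a = record
  { ι = ι′ ; new = E.new ↑ˡ k₂ ; ι-injective = ι′-injective ; ι≢new = ι′≢new ; new-or-ι = new-or-ι′
  ; ι-mono = ι′-mono ; ι-reflects = ι′-reflects ; new≤ι⁺ = new≤ι′⁺ ; new≤ι⁻ = new≤ι′⁻
  ; ι[a]≤new = ι′[a]≤new ; ι≤new⇒≡a = ι′≤new⇒≡a ; new≤new = A′.ˡˡ⁺ E.new E.new E.new≤new }
  where
  module E  = AtomExtension E
  module A  = Adjunct R C a b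
  module A′ = Adjunct R′ C (E.ι a) (E.ι b)

  ι′ : Fin (k + k₂) → Fin (k′ + k₂)
  ι′ y = Fin.join k′ k₂ (Sum.map₁ E.ι (splitAt k y))

  ι′-ˡ : ∀ j → ι′ (j ↑ˡ k₂) ≡ E.ι j ↑ˡ k₂
  ι′-ˡ j rewrite splitAt-↑ˡ k j k₂ = refl

  ι′-ʳ : ∀ c → ι′ (k ↑ʳ c) ≡ k′ ↑ʳ c
  ι′-ʳ c rewrite splitAt-↑ʳ k k₂ c = refl

  ι′-injective : ∀ y y′ → ι′ y ≡ ι′ y′ → y ≡ y′
  ι′-injective y y′ eq with split k y | split k y′
  ... | inl j | inl j′ rewrite ι′-ˡ j | ι′-ˡ j′ = cong (_↑ˡ k₂) (E.ι-injective j j′ (↑ˡ-injective k₂ _ _ eq))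
  ... | inl j | inr c′ rewrite ι′-ˡ j | ι′-ʳ c′ = ⊥-elim (↑ˡ≢↑ʳ (E.ι j) c′ eq)
  ... | inr c | inl j′ rewrite ι′-ʳ c | ι′-ˡ j′ = ⊥-elim (↑ˡ≢↑ʳ (E.ι j′) c (sym eq))
  ... | inr c | inr c′ rewrite ι′-ʳ c | ι′-ʳ c′ = cong (k ↑ʳ_) (↑ʳ-injective k′ c c′ eq)

  ι′≢new : ∀ y → ι′ y ≢ E.new ↑ˡ k₂
  ι′≢new y eq with split k y
  ... | inl j rewrite ι′-ˡ j = E.ι≢new j (↑ˡ-injective k₂ _ _ eq)
  ... | inr c rewrite ι′-ʳ c = ↑ˡ≢↑ʳ E.new c (sym eq)

  new-or-ι′ : ∀ y → y ≡ E.new ↑ˡ k₂ ⊎ ∃[ y₀ ] ι′ y₀ ≡ y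
  new-or-ι′ y with split k′ y
  ... | inr c = inj₂ (k ↑ʳ c , ι′-ʳ c)
  ... | inl j with E.new-or-ι j
  ...   | inj₁ refl        = inj₁ refl
  ...   | inj₂ (j₀ , refl) = inj₂ (j₀ ↑ˡ k₂ , ι′-ˡ j₀)

  ι′-mono : ∀ y y′ → A._⊑_ y y′ → A′._⊑_ (ι′ y) (ι′ y′)
  ι′-mono y y′ r with split k y | split k y′
  ... | inl j | inl j′ rewrite ι′-ˡ j | ι′-ˡ j′ = A′.ˡˡ⁺ _ _ (E.ι-mono j j′ (A.ˡˡ⁻ j j′ r))
  ... | inl j | inr c′ rewrite ι′-ˡ j | ι′-ʳ c′ = A′.ˡʳ⁺ _ c′ (E.ι-mono j a (A.ˡʳ⁻ j c′ r))
  ... | inr c | inl j′ rewrite ι′-ʳ c | ι′-ˡ j′ = A′.ʳˡ⁺ c _ (E.ι-mono b j′ (A.ʳˡ⁻ c j′ r))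
  ... | inr c | inr c′ rewrite ι′-ʳ c | ι′-ʳ c′ = A′.ʳʳ⁺ c c′ (A.ʳʳ⁻ c c′ r)

  ι′-reflects : ∀ y y′ → A′._⊑_ (ι′ y) (ι′ y′) → A._⊑_ y y′
  ι′-reflects y y′ r with split k y | split k y′
  ... | inl j | inl j′ rewrite ι′-ˡ j | ι′-ˡ j′ = A.ˡˡ⁺ j j′ (E.ι-reflects j j′ (A′.ˡˡ⁻ _ _ r))
  ... | inl j | inr c′ rewrite ι′-ˡ j | ι′-ʳ c′ = A.ˡʳ⁺ j c′ (E.ι-reflects j a (A′.ˡʳ⁻ _ c′ r))
  ... | inr c | inl j′ rewrite ι′-ʳ c | ι′-ˡ j′ = A.ʳˡ⁺ c j′ (E.ι-reflects b j′ (A′.ʳˡ⁻ c _ r))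
  ... | inr c | inr c′ rewrite ι′-ʳ c | ι′-ʳ c′ = A.ʳʳ⁺ c c′ (A′.ʳʳ⁻ c c′ r)

  new≤ι′⁺ : ∀ y → A._⊑_ (x ↑ˡ k₂) y → A′._⊑_ (E.new ↑ˡ k₂) (ι′ y)
  new≤ι′⁺ y r with split k y
  ... | inl j rewrite ι′-ˡ j = A′.ˡˡ⁺ E.new _ (E.new≤ι⁺ j (A.ˡˡ⁻ x j r))
  ... | inr c rewrite ι′-ʳ c = A′.ˡʳ⁺ E.new c (E.new≤ι⁺ a (A.ˡʳ⁻ x c r))

  new≤ι′⁻ : ∀ y → A′._⊑_ (E.new ↑ˡ k₂) (ι′ y) → A._⊑_ (x ↑ˡ k₂) y
  new≤ι′⁻ y r with split k y
  ... | inl j rewrite ι′-ˡ j = A.ˡˡ⁺ x j (E.new≤ι⁻ j (A′.ˡˡ⁻ E.new _ r))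
  ... | inr c rewrite ι′-ʳ c = A.ˡʳ⁺ x c (E.new≤ι⁻ a (A′.ˡʳ⁻ E.new c r))

  ι′[a]≤new : A′._⊑_ (ι′ (a ↑ˡ k₂)) (E.new ↑ˡ k₂)
  ι′[a]≤new rewrite ι′-ˡ a = A′.ˡˡ⁺ _ E.new E.ι[a]≤new

  ι′≤new⇒≡a : ∀ y → A′._⊑_ (ι′ y) (E.new ↑ˡ k₂) → y ≡ a ↑ˡ k₂
  ι′≤new⇒≡a y r with split k y
  ... | inl j rewrite ι′-ˡ j = cong (_↑ˡ k₂) (E.ι≤new⇒≡a j (A′.ˡˡ⁻ _ E.new r))
  ... | inr c rewrite ι′-ʳ c = ⊥-elim (b≢a (E.ι≤new⇒≡a b (A′.ʳˡ⁻ c E.new r)))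

atomBelowAtom : ∀ {k R} → LowerDismantlable k R → ∀ {a x} → IsBottom R a → IsMinimal R a → Covers R a x →
                Σ ℕ λ k′ → Σ (Rel k′) λ R′ → LowerDismantlable k′ R′ × AtomExtension R R′ a x
atomBelowAtom (chain m) {suc a} bot _ _ with bot zero
... | ()
atomBelowAtom (chain m) {zero} {zero} _ _ (_ , 0≢0 , _) = ⊥-elim (0≢0 refl)
atomBelowAtom (chain (suc m)) {zero} {suc zero} _ _ _ = _ , _ , chain (suc (suc m)) , chainAtomExtension m
atomBelowAtom (chain (suc (suc m))) {zero} {suc (suc x)} _ _ (_ , _ , between)
  with between (suc zero) z≤n (s≤s z≤n)
... | inj₁ ()
... | inj₂ ()
atomBelowAtom (adj {k} {R₁} L₁ a₁ b bot₁ a₁≤b a₁≢b ¬cov m) {x = x} bot min cov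
  with min (a₁ ↑ˡ suc m) (Adjunct.⊑-bottom R₁ (ChainR (suc m)) a₁ b bot₁ _)
... | refl = extend (split k x) cov
  where
  open Adjunct R₁ (ChainR (suc m)) a₁ b
  min₁ : IsMinimal R₁ a₁
  min₁ = ⊑-minimal⁻ min

  extend : ∀ {x} → Split k (suc m) x → Covers _⊑_ (a₁ ↑ˡ suc m) x →
           Σ ℕ λ k′ → Σ (Rel k′) λ R′ → LowerDismantlable k′ R′ × AtomExtension _⊑_ R′ (a₁ ↑ˡ suc m) x
  extend (inl x₁) cov with atomBelowAtom L₁ bot₁ min₁ (⊑-Covers⁻ cov)
  ... | _ , _ , L₁′ , E =
    _ , _ , adj L₁′ (ι a₁) (ι b) (ι-bottom E bot₁) (ι-mono a₁ b a₁≤b) (λ eq → a₁≢b (ι-injective a₁ b eq))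
                (ι-¬Covers E ¬cov) m
      , adjunctAtomExtension E (ChainR (suc m)) b (λ eq → a₁≢b (sym eq))
    where open AtomExtension E
  extend (inr zero) _ =
    _ , _ , adj L₁ a₁ b bot₁ a₁≤b a₁≢b ¬cov (suc m) , lengthenAdjunctChain b bot₁ min₁ m
  -- the bottom of the adjoined chain lies strictly between 0 and any other element of it
  extend (inr (suc c)) (_ , _ , between) with between (k ↑ʳ zero) (ˡʳ⁺ a₁ zero (bot₁ a₁)) (ʳʳ⁺ zero (suc c) z≤n)
  ... | inj₁ eq = ⊥-elim (↑ˡ≢↑ʳ a₁ zero (sym eq))
  ... | inj₂ eq with ↑ʳ-injective k zero (suc c) eq
  ...   | ()

-- Lower dismantlable lattices as rooted trees

Vertex : RootedTree → Set
Vertex T = Fin (suc (RootedTree.n T))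

module Ancestry (T : RootedTree) where
  open RootedTree T

  Anc⇒toℕ≤ : ∀ {w v} → Anc T w v → toℕ w ≤ toℕ v
  Anc⇒toℕ≤ here           = ℕₚ.≤-refl
  Anc⇒toℕ≤ (up {i = i} d) = ℕₚ.≤-trans (Anc⇒toℕ≤ d) (ℕₚ.≤-trans (par-lt i) (ℕₚ.n≤1+n _))

  Anc-antisym : ∀ {w v} → Anc T w v → Anc T v w → w ≡ v
  Anc-antisym d₁ d₂ = Finₚ.toℕ-injective (ℕₚ.≤-antisym (Anc⇒toℕ≤ d₁) (Anc⇒toℕ≤ d₂))

  par≢suc : ∀ i → par i ≢ suc i
  par≢suc i eq = ℕₚ.n≮n (toℕ i) (subst (λ v → toℕ v ≤ toℕ i) eq (par-lt i))

  Anc-root⁻ : ∀ {w} → Anc T w zero → w ≡ zero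
  Anc-root⁻ here = refl

  root-Anc : ∀ v → Anc T zero v
  root-Anc v = root-Anc-below (toℕ v) v ℕₚ.≤-refl
    where
    root-Anc-below : ∀ f v → toℕ v ≤ f → Anc T zero v
    root-Anc-below f       zero    _        = here
    root-Anc-below (suc f) (suc i) (s≤s le) = up (root-Anc-below f (par i) (ℕₚ.≤-trans (par-lt i) le))

  Anc-child-of-root : ∀ {i w} → par i ≡ zero → Anc T w (suc i) → w ≡ suc i ⊎ w ≡ zero
  Anc-child-of-root _   here   = inj₁ refl
  Anc-child-of-root eq (up d) = inj₂ (Anc-root⁻ (subst (Anc T _) eq d))

  Anc-linear : ∀ {w w′ v} → Anc T w v → Anc T w′ v → Anc T w w′ ⊎ Anc T w′ w
  Anc-linear here   d′      = inj₂ d′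
  Anc-linear (up d) here    = inj₁ (up d)
  Anc-linear (up d) (up d′) = Anc-linear d d′

  Anc-leaf : ∀ {w v} → (∀ i → par i ≢ w) → Anc T w v → v ≡ w
  Anc-leaf _    here           = refl
  Anc-leaf leaf (up {i = i} d) = ⊥-elim (leaf i (Anc-leaf leaf d))

  branch : ∀ v → v ≢ zero → Σ (Fin n) λ i → par i ≡ zero × Anc T (suc i) v
  branch v = branch-below (toℕ v) v ℕₚ.≤-refl
    where
    branch-below : ∀ f v → toℕ v ≤ f → v ≢ zero → Σ (Fin n) λ i → par i ≡ zero × Anc T (suc i) v
    branch-below f       zero    _        v≢0 = ⊥-elim (v≢0 refl)
    branch-below (suc f) (suc i) (s≤s le) _ with par i Finₚ.≟ zero
    ... | yes pi≡0 = i , pi≡0 , here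
    ... | no  pi≢0 with branch-below f (par i) (ℕₚ.≤-trans (par-lt i) le) pi≢0
    ...   | c , pc≡0 , d = c , pc≡0 , up d

  branch-unique : ∀ {c d v} → par c ≡ zero → par d ≡ zero → Anc T (suc c) v → Anc T (suc d) v → c ≡ d
  branch-unique pc pd dc dd with Anc-linear dc dd
  ... | inj₁ c⊑d with Anc-child-of-root pd c⊑d
  ...   | inj₁ eq = suc-injective eq
  ...   | inj₂ ()
  branch-unique pc pd dc dd | inj₂ d⊑c with Anc-child-of-root pc d⊑c
  ...   | inj₁ eq = sym (suc-injective eq)
  ...   | inj₂ ()

  otherBranch : RootHasTwoBranches T → ∀ c → Σ (Fin n) λ d → par d ≡ zero × d ≢ c
  otherBranch (i , j , i≢j , pi , pj) c with c Finₚ.≟ i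
  ... | yes refl = j , pj , λ j≡i → i≢j (sym j≡i)
  ... | no  c≢i  = i , pi , λ i≡c → c≢i (sym i≡c)

-- h identifies L ∖ {z} with the vertices of T, x ≤ y in L meaning that y is an ancestor of x;
-- the root is thus the top of L.
record TreeIso (T : RootedTree) {k : ℕ} (R : Rel k) (z : Fin k) : Set where
  field
    h           : Vertex T → Fin k
    h≢z         : ∀ v → h v ≢ z
    h-injective : ∀ v w → h v ≡ h w → v ≡ w
    h-onto      : ∀ x → x ≢ z → ∃[ v ] h v ≡ x
    Anc⇒≤       : ∀ {v w} → Anc T w v → R (h v) (h w)
    ≤⇒Anc       : ∀ v w → R (h v) (h w) → Anc T w v
    z-bottom    : IsBottom R z
    z-minimal   : IsMinimal R z

Tree : ℕ → Set
Tree n = Σ (Fin n → Fin (suc n)) λ par → ∀ i → toℕ (par i) ≤ toℕ i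

⌊_⌋ : ∀ {n} → Tree n → RootedTree
⌊ par , par-lt ⌋ = record { par = par ; par-lt = par-lt }

record LeafExtension {n : ℕ} (T′ : Tree n) (T : Tree (suc n)) (p : Fin (suc n)) : Set where
  field
    par-inject₁ : ∀ i → proj₁ T (inject₁ i) ≡ inject₁ (proj₁ T′ i)
    par-last    : proj₁ T (fromℕ n) ≡ inject₁ p

addLeaf : ∀ {n} (T′ : Tree n) (p : Fin (suc n)) → Σ (Tree (suc n)) λ T → LeafExtension T′ T p
addLeaf {n} (par′ , par′-lt) p = (par , par-lt) , record { par-inject₁ = par-inject₁ ; par-last = par-last }
  where
  par : Fin (suc n) → Fin (suc (suc n))
  par i with Top.view i
  ... | Top.‵fromℕ     = inject₁ p
  ... | Top.‵inject₁ j = inject₁ (par′ j)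

  par-lt : ∀ i → toℕ (par i) ≤ toℕ i
  par-lt i with Top.view i
  ... | Top.‵fromℕ rewrite Finₚ.toℕ-inject₁ p | Finₚ.toℕ-fromℕ n = ℕ.s≤s⁻¹ (Finₚ.toℕ<n p)
  ... | Top.‵inject₁ j rewrite Finₚ.toℕ-inject₁ (par′ j) | Finₚ.toℕ-inject₁ j = par′-lt j

  par-inject₁ : ∀ i → par (inject₁ i) ≡ inject₁ (par′ i)
  par-inject₁ i rewrite Top.view-inject₁ i = refl

  par-last : par (fromℕ n) ≡ inject₁ p
  par-last rewrite Top.view-fromℕ n = refl

removeLastLeaf : ∀ {n} (T : Tree (suc n)) → Σ (Tree n) λ T′ → Σ (Fin (suc n)) λ p → LeafExtension T′ T p
removeLastLeaf {n} (par , par-lt) =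
  (par′ , par′-lt) , p , record { par-inject₁ = par-inject₁ ; par-last = par-last }
  where
  par[inject₁]<1+n : ∀ i → toℕ (par (inject₁ i)) < suc n
  par[inject₁]<1+n i = s≤s (ℕₚ.≤-trans (par-lt (inject₁ i))
                                        (ℕₚ.≤-trans (ℕₚ.≤-reflexive (Finₚ.toℕ-inject₁ i)) (ℕₚ.<⇒≤ (Finₚ.toℕ<n i))))

  par′ : Fin n → Fin (suc n)
  par′ i = fromℕ< (par[inject₁]<1+n i)

  par′-lt : ∀ i → toℕ (par′ i) ≤ toℕ i
  par′-lt i rewrite Finₚ.toℕ-fromℕ< (par[inject₁]<1+n i) | sym (Finₚ.toℕ-inject₁ i) = par-lt (inject₁ i)

  par-inject₁ : ∀ i → par (inject₁ i) ≡ inject₁ (par′ i)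
  par-inject₁ i = Finₚ.toℕ-injective
    (sym (trans (Finₚ.toℕ-inject₁ (par′ i)) (Finₚ.toℕ-fromℕ< (par[inject₁]<1+n i))))

  par[last]<1+n : toℕ (par (fromℕ n)) < suc n
  par[last]<1+n = s≤s (ℕₚ.≤-trans (par-lt (fromℕ n)) (ℕₚ.≤-reflexive (Finₚ.toℕ-fromℕ n)))

  p : Fin (suc n)
  p = fromℕ< par[last]<1+n

  par-last : par (fromℕ n) ≡ inject₁ p
  par-last = Finₚ.toℕ-injective (sym (trans (Finₚ.toℕ-inject₁ p) (Finₚ.toℕ-fromℕ< par[last]<1+n)))

module LeafExtensionAnc {n} {T′ : Tree n} {T : Tree (suc n)} {p} (ext : LeafExtension T′ T p) where
  open LeafExtension ext

  leaf : Fin (suc (suc n))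
  leaf = fromℕ (suc n)

  inject₁-Anc⁺ : ∀ {w v} → Anc ⌊ T′ ⌋ w v → Anc ⌊ T ⌋ (inject₁ w) (inject₁ v)
  inject₁-Anc⁺ here           = here
  inject₁-Anc⁺ (up {i = i} d) = up (subst (Anc ⌊ T ⌋ _) (sym (par-inject₁ i)) (inject₁-Anc⁺ d))

  ancestors-of-old : ∀ {w′ u} → Anc ⌊ T ⌋ w′ u → ∀ v → u ≡ inject₁ v →
                     ∃[ w ] w′ ≡ inject₁ w × Anc ⌊ T′ ⌋ w v
  ancestors-of-old here   v       eq = v , eq , here
  ancestors-of-old (up d) (suc v) eq with suc-injective eq
  ... | refl with ancestors-of-old d (proj₁ T′ v) (par-inject₁ v)
  ...   | w , w′≡w , d′ = w , w′≡w , up d′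

  inject₁-Anc⁻ : ∀ {w v} → Anc ⌊ T ⌋ (inject₁ w) (inject₁ v) → Anc ⌊ T′ ⌋ w v
  inject₁-Anc⁻ {v = v} d with ancestors-of-old d v refl
  ... | _ , eq , d′ rewrite Finₚ.inject₁-injective eq = d′

  leaf-Anc⁺ : ∀ {w} → Anc ⌊ T ⌋ w (inject₁ p) → Anc ⌊ T ⌋ w leaf
  leaf-Anc⁺ d = up (subst (Anc ⌊ T ⌋ _) (sym par-last) d)

  leaf-Anc⁻ : ∀ {w} → Anc ⌊ T ⌋ w leaf → w ≡ leaf ⊎ Anc ⌊ T ⌋ w (inject₁ p)
  leaf-Anc⁻ here   = inj₁ refl
  leaf-Anc⁻ (up d) = inj₂ (subst (Anc ⌊ T ⌋ _) par-last d)

  leaf-¬Anc : ∀ {v} → ¬ Anc ⌊ T ⌋ leaf (inject₁ v)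
  leaf-¬Anc {v} d = ℕₚ.<⇒≱ inject₁v<leaf (Ancestry.Anc⇒toℕ≤ ⌊ T ⌋ d)
    where
    inject₁v<leaf : toℕ (inject₁ v) < toℕ leaf
    inject₁v<leaf rewrite Finₚ.toℕ-inject₁ v | Finₚ.toℕ-fromℕ (suc n) = Finₚ.toℕ<n v

leafExtension-TreeIso : ∀ {n} {T′ : Tree n} {T : Tree (suc n)} {p} → LeafExtension T′ T p →
  ∀ {k k′} {R : Rel k} {R′ : Rel k′} {a x} → (iso : TreeIso ⌊ T′ ⌋ R a) → (E : AtomExtension R R′ a x) →
  TreeIso.h iso p ≡ x → TreeIso ⌊ T ⌋ R′ (AtomExtension.ι E a)
leafExtension-TreeIso {n} {p = p} ext {R = R} {R′} {a} {x} iso E hp≡x = record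
  { h = h ; h≢z = h≢ιa ; h-injective = h-injective ; h-onto = h-onto
  ; Anc⇒≤ = λ {v} {w} → Anc⇒≤ v w ; ≤⇒Anc = ≤⇒Anc
  ; z-bottom = ι-bottom E I.z-bottom ; z-minimal = ι-minimal E x≢a I.z-minimal }
  where
  module I = TreeIso iso
  open AtomExtension E
  open LeafExtensionAnc ext

  h : Fin (suc (suc n)) → _
  h v with Top.view v
  ... | Top.‵fromℕ     = new
  ... | Top.‵inject₁ j = ι (I.h j)

  h-leaf : h leaf ≡ new
  h-leaf rewrite Top.view-fromℕ (suc n) = refl

  h-inject₁ : ∀ j → h (inject₁ j) ≡ ι (I.h j)
  h-inject₁ j rewrite Top.view-inject₁ j = refl

  x≢a : x ≢ a
  x≢a x≡a = I.h≢z p (trans hp≡x x≡a)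

  h≢ιa : ∀ v → h v ≢ ι a
  h≢ιa v with Top.view v
  ... | Top.‵fromℕ     = λ eq → ι≢new a (sym eq)
  ... | Top.‵inject₁ j = λ eq → I.h≢z j (ι-injective _ _ eq)

  h-injective : ∀ v w → h v ≡ h w → v ≡ w
  h-injective v w eq with Top.view v | Top.view w
  ... | Top.‵fromℕ     | Top.‵fromℕ      = refl
  ... | Top.‵fromℕ     | Top.‵inject₁ _  = ⊥-elim (ι≢new _ (sym eq))
  ... | Top.‵inject₁ _ | Top.‵fromℕ      = ⊥-elim (ι≢new _ eq)
  ... | Top.‵inject₁ j | Top.‵inject₁ j′ = cong inject₁ (I.h-injective j j′ (ι-injective _ _ eq))

  h-onto : ∀ y → y ≢ ι a → ∃[ v ] h v ≡ y
  h-onto y y≢ιa with new-or-ι y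
  ... | inj₁ refl        = leaf , h-leaf
  ... | inj₂ (y₀ , refl) with I.h-onto y₀ (λ eq → y≢ιa (cong ι eq))
  ...   | j , refl = inject₁ j , h-inject₁ j

  Anc⇒≤ : ∀ v w → Anc ⌊ _ ⌋ w v → R′ (h v) (h w)
  Anc⇒≤ v w d with Top.view v | Top.view w
  ... | Top.‵fromℕ     | Top.‵fromℕ      = new≤new
  ... | Top.‵inject₁ _ | Top.‵fromℕ      = ⊥-elim (leaf-¬Anc d)
  ... | Top.‵inject₁ j | Top.‵inject₁ j′ = ι-mono _ _ (I.Anc⇒≤ (inject₁-Anc⁻ d))
  ... | Top.‵fromℕ     | Top.‵inject₁ j′ with leaf-Anc⁻ d
  ...   | inj₁ eq = ⊥-elim (Finₚ.fromℕ≢inject₁ (sym eq))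
  ...   | inj₂ d′ = new≤ι⁺ _ (subst (λ q → R q (I.h j′)) hp≡x (I.Anc⇒≤ (inject₁-Anc⁻ d′)))

  ≤⇒Anc : ∀ v w → R′ (h v) (h w) → Anc ⌊ _ ⌋ w v
  ≤⇒Anc v w r with Top.view v | Top.view w
  ... | Top.‵fromℕ     | Top.‵fromℕ      = here
  ... | Top.‵inject₁ j | Top.‵fromℕ      = ⊥-elim (I.h≢z j (ι≤new⇒≡a _ r))
  ... | Top.‵inject₁ j | Top.‵inject₁ j′ = inject₁-Anc⁺ (I.≤⇒Anc j j′ (ι-reflects _ _ r))
  ... | Top.‵fromℕ     | Top.‵inject₁ j′ =
    leaf-Anc⁺ (inject₁-Anc⁺ (I.≤⇒Anc p j′ (subst (λ q → R q (I.h j′)) (sym hp≡x) (new≤ι⁻ _ r))))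

growTreeIso : ∀ {T k k′} {R : Rel k} {R′ : Rel k′} {a x z′} → TreeIso T R a → AtomExtension R R′ a x →
              x ≢ a → IsBottom R′ z′ → Σ RootedTree λ T′ → TreeIso T′ R′ z′
growTreeIso {T} {R′ = R′} {z′ = z′} iso E x≢a z′-bottom with TreeIso.h-onto iso _ x≢a
... | p , hp≡x with addLeaf (RootedTree.par T , RootedTree.par-lt T) p
...   | T′ , ext = ⌊ T′ ⌋ , subst (TreeIso ⌊ T′ ⌋ R′) (sym z′≡ιa) iso′
  where
  iso′ : TreeIso ⌊ T′ ⌋ R′ (AtomExtension.ι E _)
  iso′ = leafExtension-TreeIso ext iso E hp≡x
  z′≡ιa : z′ ≡ AtomExtension.ι E _
  z′≡ιa = TreeIso.z-minimal iso′ _ (z′-bottom _)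

module TreeIsoProperties {T k} {R : Rel k} {z} (iso : TreeIso T R z) where
  open TreeIso iso
  open RootedTree T
  open Ancestry T

  leaf⇒Covers : ∀ {v} → (∀ i → par i ≢ v) → Covers R z (h v)
  leaf⇒Covers {v} leaf = z-bottom (h v) , (λ eq → h≢z v (sym eq)) , between
    where
    between : ∀ c → R z c → R c (h v) → c ≡ z ⊎ c ≡ h v
    between c _ c≤hv with c Finₚ.≟ z
    ... | yes c≡z = inj₁ c≡z
    ... | no  c≢z with h-onto c c≢z
    ...   | u , refl = inj₂ (cong h (Anc-leaf leaf (≤⇒Anc u v c≤hv)))

  child⇒¬Covers : ∀ {i v} → par i ≡ v → ¬ Covers R z (h v)
  child⇒¬Covers {i} {v} pi≡v (_ , _ , between)
    with between (h (suc i)) (z-bottom _) (Anc⇒≤ (up (subst (Anc T v) (sym pi≡v) here)))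
  ... | inj₁ hi≡z = h≢z (suc i) hi≡z
  ... | inj₂ hi≡hv = par≢suc i (trans pi≡v (sym (h-injective _ _ hi≡hv)))

  ≤-refl : ∀ x → R x x
  ≤-refl x with x Finₚ.≟ z
  ... | yes refl = z-bottom z
  ... | no  x≢z with h-onto x x≢z
  ...   | _ , refl = Anc⇒≤ here

  ≤-antisym : ∀ {x y} → R x y → R y x → x ≡ y
  ≤-antisym {x} {y} x≤y y≤x with x Finₚ.≟ z | y Finₚ.≟ z
  ... | yes refl | _        = sym (z-minimal y y≤x)
  ... | no  _    | yes refl = z-minimal x x≤y
  ... | no  x≢z  | no  y≢z with h-onto x x≢z | h-onto y y≢z
  ...   | v , refl | w , refl = cong h (Anc-antisym (≤⇒Anc w v y≤x) (≤⇒Anc v w x≤y))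

  root-top : IsTop R (h zero)
  root-top x with x Finₚ.≟ z
  ... | yes refl = z-bottom _
  ... | no  x≢z with h-onto x x≢z
  ...   | v , refl = Anc⇒≤ (root-Anc v)

  h-root≡top : ∀ {t} → IsTop R t → h zero ≡ t
  h-root≡top t-top = ≤-antisym (t-top _) (root-top _)

  nonTop-vertex : ∀ {t x} → IsTop R t → x ≢ z → x ≢ t → ∃[ v ] v ≢ zero × h v ≡ x
  nonTop-vertex t-top x≢z x≢t with h-onto _ x≢z
  ... | v , refl = v , (λ { refl → x≢t (h-root≡top t-top) }) , refl

  -- The ancestors of a common lower bound form a chain, so x and y would be comparable.
  incomparable⇒meet≡z : ∀ {x y} → x ≢ z → y ≢ z → Incomparable R x y → MeetIs R x y z
  incomparable⇒meet≡z {x} {y} x≢z y≢z (x≰y , y≰x) = z-bottom x , z-bottom y , lower-bound≤z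
    where
    lower-bound≤z : ∀ w → R w x → R w y → R w z
    lower-bound≤z w w≤x w≤y with w Finₚ.≟ z
    ... | yes refl = z-bottom z
    ... | no  w≢z with h-onto w w≢z | h-onto x x≢z | h-onto y y≢z
    ...   | u , refl | v , refl | v′ , refl with Anc-linear (≤⇒Anc u v w≤x) (≤⇒Anc u v′ w≤y)
    ...     | inj₁ v⊑v′ = ⊥-elim (y≰x (Anc⇒≤ v⊑v′))
    ...     | inj₂ v′⊑v = ⊥-elim (x≰y (Anc⇒≤ v′⊑v))

  meet≡z⇒incomparable : ∀ {x y} → x ≢ z → y ≢ z → MeetIs R x y z → Incomparable R x y
  meet≡z⇒incomparable {x} {y} x≢z y≢z (_ , _ , glb) =
    (λ x≤y → x≢z (z-minimal x (glb x (≤-refl x) x≤y))) , (λ y≤x → y≢z (z-minimal y (glb y y≤x (≤-refl y))))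

  meet≡z⇒≢top : ∀ {t x y} → IsTop R t → y ≢ z → MeetIs R x y z → x ≢ t
  meet≡z⇒≢top {y = y} t-top y≢z (_ , _ , glb) refl = y≢z (z-minimal y (glb y (t-top y) (≤-refl y)))

  otherBranch-incomparable : ∀ {c d v} → par c ≡ zero → par d ≡ zero → d ≢ c → Anc T (suc c) v → v ≢ zero →
                             Incomparable R (h v) (h (suc d))
  otherBranch-incomparable {c} {d} {v} pc pd d≢c dc v≢0 = v≰d , d≰v
    where
    v≰d : ¬ R (h v) (h (suc d))
    v≰d r = d≢c (branch-unique pd pc (≤⇒Anc v (suc d) r) dc)
    d≰v : ¬ R (h (suc d)) (h v)
    d≰v r with Anc-child-of-root pd (≤⇒Anc (suc d) v r)
    ... | inj₁ refl = d≢c (branch-unique pd pc here dc)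
    ... | inj₂ v≡0  = v≢0 v≡0

  zeroDivisor-partner : RootHasTwoBranches T → ∀ {t x} → IsTop R t → x ≢ z → x ≢ t →
                        ∃[ y ] y ≢ z × MeetIs R x y z
  zeroDivisor-partner two t-top x≢z x≢t with nonTop-vertex t-top x≢z x≢t
  ... | v , v≢0 , refl with branch v v≢0
  ...   | c , pc , dc with otherBranch two c
  ...     | d , pd , d≢c =
    h (suc d) , h≢z _ , incomparable⇒meet≡z x≢z (h≢z _) (otherBranch-incomparable pc pd d≢c dc v≢0)

  join-with-bottom : ∀ {y t} → JoinIs R z y t → y ≡ t
  join-with-bottom {y} (_ , y≤t , lub) = ≤-antisym y≤t (lub y (z-bottom y) (≤-refl y))

  h-child≢root : ∀ c → h (suc c) ≢ h zero
  h-child≢root c eq with h-injective _ _ eq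
  ... | ()

  -- If x ∨ y = t with x, y ≠ t, then x and y lie below different children c, d of the root:
  -- for c = d, h (suc c) would be an upper bound of x and y strictly below t.
  joinReducible⇒twoBranches : ∀ {t} → IsTop R t → JoinReducible R t → RootHasTwoBranches T
  joinReducible⇒twoBranches {t} t-top (x , y , x≢t , y≢t , x≤t , y≤t , lub)
    with nonTop-vertex t-top (λ { refl → y≢t (join-with-bottom (x≤t , y≤t , lub)) }) x≢t
       | nonTop-vertex t-top (λ { refl → x≢t (join-with-bottom (y≤t , x≤t , λ w r₁ r₂ → lub w r₂ r₁)) }) y≢t
  ... | v , v≢0 , refl | w , w≢0 , refl with branch v v≢0 | branch w w≢0
  ...   | c , pc , dc | d , pd , dd with c Finₚ.≟ d
  ...     | no  c≢d  = c , d , c≢d , pc , pd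
  ...     | yes refl = ⊥-elim (h-child≢root c (trans hc≡t (sym (h-root≡top t-top))))
    where
    hc≡t : h (suc c) ≡ t
    hc≡t = ≤-antisym (t-top _) (lub _ (Anc⇒≤ dc) (Anc⇒≤ dd))

  twoBranches⇒joinReducible : RootHasTwoBranches T → JoinReducible R (h zero)
  twoBranches⇒joinReducible (i , j , i≢j , pi , pj) =
    h (suc i) , h (suc j) , h-child≢root i , h-child≢root j , root-top _ , root-top _ , lub
    where
    lub : ∀ w → R (h (suc i)) w → R (h (suc j)) w → R (h zero) w
    lub w hi≤w hj≤w with w Finₚ.≟ z
    ... | yes refl = ⊥-elim (h≢z (suc i) (z-minimal _ hi≤w))
    ... | no  w≢z with h-onto w w≢z
    ...   | u , refl with Anc-child-of-root pi (≤⇒Anc (suc i) u hi≤w) | Anc-child-of-root pj (≤⇒Anc (suc j) u hj≤w)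
    ...     | inj₂ refl | _         = ≤-refl _
    ...     | inj₁ _    | inj₂ refl = ≤-refl _
    ...     | inj₁ u≡i  | inj₁ u≡j  = ⊥-elim (i≢j (suc-injective (trans (sym u≡i) u≡j)))

  nonAncestor≅incomparability : ∀ {t} → IsTop R t → FinGraphIso (NonAncestorGraph T) (IncompGraph01 R z t)
  nonAncestor≅incomparability t-top = record
    { g = h
    ; g-in = λ v v≢0 → h≢z v , λ hv≡t → v≢0 (h-injective v zero (trans hv≡t (sym (h-root≡top t-top))))
    ; g-injective = λ v w _ _ → h-injective v w
    ; g-onto = λ { y (y≢z , y≢t) → nonTop-vertex t-top y≢z y≢t }
    ; g-adj = λ v w _ _ (v⋢w , w⋢v) → (λ r → w⋢v (≤⇒Anc v w r)) , (λ r → v⋢w (≤⇒Anc w v r))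
    ; g-adj⁻ = λ v w _ _ (hv≰hw , hw≰hv) → (λ d → hw≰hv (Anc⇒≤ d)) , (λ d → hv≰hw (Anc⇒≤ d))
    }

  module _ (two : RootHasTwoBranches T) {t} (t-top : IsTop R t) where
    private
      zeroDivisor⇒nonTop : ∀ x → FinGraph.S (ZeroDivisorGraph R z) x → FinGraph.S (IncompGraph01 R z t) x
      zeroDivisor⇒nonTop x (x≢z , y , y≢z , meet) = x≢z , meet≡z⇒≢top t-top y≢z meet

      nonTop⇒zeroDivisor : ∀ x → FinGraph.S (IncompGraph01 R z t) x → FinGraph.S (ZeroDivisorGraph R z) x
      nonTop⇒zeroDivisor x (x≢z , x≢t) = x≢z , zeroDivisor-partner two t-top x≢z x≢t

      zeroDivisor-adj⇒incomparable : ∀ {x y} → x ≢ z → y ≢ z → x ≢ y × MeetIs R x y z → Incomparable R x y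
      zeroDivisor-adj⇒incomparable x≢z y≢z (_ , meet) = meet≡z⇒incomparable x≢z y≢z meet

      incomparable⇒zeroDivisor-adj : ∀ {x y} → x ≢ z → y ≢ z → Incomparable R x y → x ≢ y × MeetIs R x y z
      incomparable⇒zeroDivisor-adj {x} x≢z y≢z inc =
        (λ { refl → proj₁ inc (≤-refl x) }) , incomparable⇒meet≡z x≢z y≢z inc

    zeroDivisor≅incomparability : FinGraphIso (ZeroDivisorGraph R z) (IncompGraph01 R z t)
    zeroDivisor≅incomparability = sameVertices-FinGraphIso zeroDivisor⇒nonTop nonTop⇒zeroDivisor
      (λ _ _ Sx Sy → zeroDivisor-adj⇒incomparable (proj₁ Sx) (proj₁ Sy))
      (λ _ _ Sx Sy → incomparable⇒zeroDivisor-adj (proj₁ Sx) (proj₁ Sy))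

    incomparability≅zeroDivisor : FinGraphIso (IncompGraph01 R z t) (ZeroDivisorGraph R z)
    incomparability≅zeroDivisor = sameVertices-FinGraphIso nonTop⇒zeroDivisor zeroDivisor⇒nonTop
      (λ _ _ Sx Sy → incomparable⇒zeroDivisor-adj (proj₁ Sx) (proj₁ Sy))
      (λ _ _ Sx Sy → zeroDivisor-adj⇒incomparable (proj₁ Sx) (proj₁ Sy))

twoElementChain-TreeIso : (T : Tree 0) → TreeIso ⌊ T ⌋ (ChainR 2) zero
twoElementChain-TreeIso T = record
  { h = λ _ → suc zero
  ; h≢z = λ _ ()
  ; h-injective = λ { zero zero _ → refl }
  ; h-onto = λ { zero 0≢0 → ⊥-elim (0≢0 refl) ; (suc zero) _ → zero , refl }
  ; Anc⇒≤ = λ _ → s≤s z≤n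
  ; ≤⇒Anc = λ { zero zero _ → here }
  ; z-bottom = λ _ → z≤n
  ; z-minimal = λ { zero _ → refl ; (suc _) () } }

chain-TreeIso : ∀ m → Σ RootedTree λ T → TreeIso T (ChainR (suc (suc m))) zero
chain-TreeIso zero    = ⌊ (λ ()) , (λ ()) ⌋ , twoElementChain-TreeIso _
chain-TreeIso (suc m) with chain-TreeIso m
... | T , iso = growTreeIso iso (chainAtomExtension m) (λ ()) (λ _ → z≤n)

lowerDismantlable⇒TreeIso : ∀ {k R} → LowerDismantlable k R → ∀ {u v z : Fin k} → u ≢ v → IsBottom R z →
                            Σ RootedTree λ T → TreeIso T R z
lowerDismantlable⇒TreeIso (chain zero)    {zero} {zero} u≢v _ = ⊥-elim (u≢v refl)
lowerDismantlable⇒TreeIso (chain (suc m)) {z = zero}  _ _   = chain-TreeIso m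
lowerDismantlable⇒TreeIso (chain (suc m)) {z = suc _} _ bot with bot zero
... | ()
lowerDismantlable⇒TreeIso (adj {k} {R₁} L₁ a₁ b bot₁ _ a₁≢b _ m) _ bot
  with lowerDismantlable⇒TreeIso L₁ a₁≢b bot₁
... | T₁ , iso₁ = adjunct-TreeIso m bot
  where
  min₁ : IsMinimal R₁ a₁
  min₁ = TreeIso.z-minimal iso₁

  adjunct-TreeIso : ∀ len {z} → IsBottom (AdjR k R₁ (ChainR (suc len)) a₁ b) z →
                    Σ RootedTree λ T → TreeIso T (AdjR k R₁ (ChainR (suc len)) a₁ b) z
  adjunct-TreeIso zero      bot = growTreeIso iso₁ (adjoinPoint b bot₁ min₁) (λ eq → a₁≢b (sym eq)) bot
  adjunct-TreeIso (suc len) bot with adjunct-TreeIso len (Adjunct.⊑-bottom R₁ (ChainR (suc len)) a₁ b bot₁)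
  ... | _ , iso = growTreeIso iso (lengthenAdjunctChain b bot₁ min₁ len) (λ eq → ↑ˡ≢↑ʳ a₁ zero (sym eq)) bot

tree⇒lowerDismantlable : ∀ {n} (T : Tree n) →
  Σ ℕ λ k → Σ (Rel k) λ R → LowerDismantlable k R × Σ (Fin k) λ z → TreeIso ⌊ T ⌋ R z
tree⇒lowerDismantlable {zero} T = 2 , ChainR 2 , chain 1 , zero , twoElementChain-TreeIso T
tree⇒lowerDismantlable {suc n} T with removeLastLeaf T
... | T′ , p , ext with tree⇒lowerDismantlable T′
...   | _ , _ , L , z , iso = attach (Finₚ.any? λ i → proj₁ T′ i Finₚ.≟ p)
  where
  open TreeIso iso
  open TreeIsoProperties iso

  attach : Dec (∃ λ i → proj₁ T′ i ≡ p) →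
           Σ ℕ λ k → Σ (Rel k) λ R → LowerDismantlable k R × Σ (Fin k) λ z → TreeIso ⌊ T ⌋ R z
  attach (yes (_ , pi≡p)) =
    _ , _ , adj L z (h p) z-bottom (z-bottom _) (λ eq → h≢z p (sym eq)) (child⇒¬Covers pi≡p) 0 ,
    _ , leafExtension-TreeIso ext iso (adjoinPoint (h p) z-bottom z-minimal) refl
  attach (no no-child) with atomBelowAtom L z-bottom z-minimal (leaf⇒Covers λ i eq → no-child (i , eq))
  ... | _ , _ , L′ , E = _ , _ , L′ , _ , leafExtension-TreeIso ext iso E refl

lowerDismantlable⇒twoBranchTree : ∀ {k R} → LowerDismantlable k R → ∀ {z t} → IsBottom R z → IsTop R t →
  JoinReducible R t → Σ RootedTree λ T → RootHasTwoBranches T × TreeIso T R z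
lowerDismantlable⇒twoBranchTree L z-bottom t-top t-reducible@(_ , _ , x≢t , _)
  with lowerDismantlable⇒TreeIso L x≢t z-bottom
... | T , iso = T , TreeIsoProperties.joinReducible⇒twoBranches iso t-top t-reducible , iso

A⇒C : ∀ G → CondA G → CondC G
A⇒C G (T , two , G≅T) with tree⇒lowerDismantlable (RootedTree.par T , RootedTree.par-lt T)
... | k , R , L , z , iso =
  k , R , L , z , h zero , z-bottom , root-top , twoBranches⇒joinReducible two ,
  ≅-trans G≅T (nonAncestor≅incomparability root-top)
  where
  open TreeIso iso
  open TreeIsoProperties iso

C⇒A : ∀ G → CondC G → CondA G
C⇒A G (k , R , L , z , t , z-bottom , t-top , t-reducible , G≅I)
  with lowerDismantlable⇒twoBranchTree L z-bottom t-top t-reducible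
... | T , two , iso = T , two , ≅-trans⁻¹ G≅I (TreeIsoProperties.nonAncestor≅incomparability iso t-top)

B⇒C : ∀ G → CondB G → CondC G
B⇒C G (k , R , L , z , t , z-bottom , t-top , t-reducible , G≅Z)
  with lowerDismantlable⇒twoBranchTree L z-bottom t-top t-reducible
... | T , two , iso =
  k , R , L , z , t , z-bottom , t-top , t-reducible ,
  ≅-trans G≅Z (TreeIsoProperties.zeroDivisor≅incomparability iso two t-top)

C⇒B : ∀ G → CondC G → CondB G
C⇒B G (k , R , L , z , t , z-bottom , t-top , t-reducible , G≅I)
  with lowerDismantlable⇒twoBranchTree L z-bottom t-top t-reducible
... | T , two , iso =
  k , R , L , z , t , z-bottom , t-top , t-reducible ,
  ≅-trans G≅I (TreeIsoProperties.incomparability≅zeroDivisor iso two t-top)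

theorem1p1 : (G : SimpleGraph) → (CondA G ⇔ CondB G) × (CondB G ⇔ CondC G)
theorem1p1 G = ((λ a → C⇒B G (A⇒C G a)) , (λ b → C⇒A G (B⇒C G b))) , (B⇒C G , C⇒B G)
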